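{- Let $Y_n$ be the set of standard Young tableaux of size $n$ (of any shape), $V = \bigcup_{n \geq 0} Y_n$, and $\mathbb{C}(q)[V]$ the $\mathbb{C}(q)$-vector space with basis $V$. Define linear operators $U, D$ as follows. For $P \in Y_n$, $$U(P) = \sum_{k=1}^{n+1} q^{\,n+1-k}\, \mathrm{ins}_k(P),$$ where $\mathrm{ins}_k(P) \in Y_{n+1}$ is obtained from $P$ by first increasing every entry of $P$ that is $\geq k$ by $1$, and then Schensted row-inserting $k$. For $P' \in Y_{n+1}$, $D(P') \in Y_n$ is the tableau obtained from $P'$ by removing the entry $n+1$; and $D$ of the empty tableau is $0$. Then $DU - qUD = I$.
   Context: Schensted insertion is the usual row insertion of the Robinson–Schensted algorithm. Equivalently, $(\mathrm{Tab},\mathrm{Tab}')$ is a pair of quantized dual graded graphs with differential coefficient $1$. -}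

module Defs where

open import Data.Nat using (ℕ; zero; suc; _+_; _∸_; _<_; _≤ᵇ_; _≡ᵇ_)
open import Data.Bool using (Bool; true; false; if_then_else_)
open import Data.List using (List; []; _∷_; map; concat; concatMap; upTo; length; filter)
open import Data.Nat.ListAction using (sum)
open import Data.List.Relation.Unary.All using (All)
open import Data.List.Relation.Unary.Linked using (Linked)
open import Data.List.Relation.Binary.Permutation.Propositional using (_↭_)
open import Data.Maybe using (Maybe; just; nothing)
open import Data.Product using (_×_; _,_)
open import Data.Unit using (⊤)
open import Data.Empty using (⊥)

-- Tableaux in English notation: a list of rows, top row first.

Tableau : Set
Tableau = List (List ℕ)

size : Tableau → ℕ
size T = sum (map length T)

NonEmptyRow : List ℕ → Set
NonEmptyRow []      = ⊥
NonEmptyRow (_ ∷ _) = ⊤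

-- 'Below r r′' : row r′ sits directly below row r: |r′| ≤ |r| and
-- entries strictly increase down each column.
Below : List ℕ → List ℕ → Set
Below _        []       = ⊤
Below []       (_ ∷ _)  = ⊥
Below (x ∷ xs) (y ∷ ys) = (x < y) × Below xs ys

record IsSYT (n : ℕ) (T : Tableau) : Set where
  field
    rowsNonEmpty : All NonEmptyRow T
    rowsIncr     : All (Linked _<_) T
    colsIncr     : Linked Below T
    entries      : concat T ↭ map suc (upTo n)

bump : ℕ → List ℕ → List ℕ × Maybe ℕ
bump x []       = x ∷ [] , nothing
bump x (y ∷ ys) with suc x ≤ᵇ y
... | true  = x ∷ ys , just y
... | false with bump x ys
...   | ys′ , r = y ∷ ys′ , r

rowInsert : ℕ → Tableau → Tableau
rowInsert x []       = (x ∷ []) ∷ []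
rowInsert x (r ∷ rs) with bump x r
... | r′ , nothing = r′ ∷ rs
... | r′ , just y  = r′ ∷ rowInsert y rs

ins : ℕ → Tableau → Tableau
ins k P = rowInsert k (map (map (λ e → if k ≤ᵇ e then suc e else e)) P)

removeEntry : ℕ → Tableau → Tableau
removeEntry m T = filter nonEmpty? (map (filter (λ e → ¬? (e ≟ m))) T)
  where
  open import Data.Nat using (_≟_)
  open import Relation.Nullary using (¬?; yes; no)
  open import Relation.Unary using (Decidable)
  nonEmpty? : Decidable NonEmptyRow
  nonEmpty? []      = no (λ ())
  nonEmpty? (_ ∷ _) = yes _

-- Formal linear combinations of tableaux whose coefficients are
-- (sums of) monomials in q:  a list of pairs (e , T) stands for the
-- sum of the terms q^e · T.  Two such combinations are equal as
-- elements of ℂ(q)[V] iff they are equal as multisets, i.e. iff the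
-- lists are permutations of each other (_↭_).

LinComb : Set
LinComb = List (ℕ × Tableau)

qScale : LinComb → LinComb
qScale = map (λ { (e , T) → suc e , T })

Ubasis : Tableau → LinComb
Ubasis P = map (λ k → (suc n ∸ suc k , ins (suc k) P)) (upTo (suc n))
  where n = size P

Dbasis : Tableau → LinComb
Dbasis P with size P
... | zero  = []
... | suc n = (0 , removeEntry (suc n) P) ∷ []

Ulin : LinComb → LinComb
Ulin = concatMap (λ { (e , T) → map (λ { (e′ , T′) → e + e′ , T′ }) (Ubasis T) })

Dlin : LinComb → LinComb
Dlin = concatMap (λ { (e , T) → map (λ { (e′ , T′) → e + e′ , T′ }) (Dbasis T) })

U D : Tableau → LinComb
U P = Ulin ((0 , P) ∷ [])
D P = Dlin ((0 , P) ∷ [])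

-- Write ins_k(P) as the row insertion of k into P with its entries ≥ k shifted up, and
-- remove the largest entry n + 1. For k = n + 1 the inserted entry is itself the maximum
-- and lands at the end of the first row, so removing it returns P: the identity term.
-- For k ≤ n the maximum is the shifted image of n and ends its row, so removing it
-- commutes with inserting a smaller value: the bumping path either avoids it, or bumps
-- it to the end of the next row, from where it is removed just the same. Hence
-- D ins_k(P) = ins_k(D P), and since q^(n+1-k) = q · q^(n-k) these terms form q·U D P.
module Submission where

open import Defs
open import Data.Nat using (ℕ; zero; suc; _+_; _∸_; _<_; _≤_; _≤ᵇ_; s≤s)
open import Data.Nat.Properties
open import Data.Bool using (true; false; if_then_else_)
open import Data.List using (List; []; _∷_; _++_; _∷ʳ_; [_]; map; filter; concat; length; upTo; fromMaybe)
open import Data.List.Properties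
  using (filter-accept; filter-reject; filter-all; filter-++; ++-identityʳ; length-++; length-map;
         length-upTo; upTo-∷ʳ; map-++; map-∘; map-id-local; map-cong-local)
open import Data.List.Relation.Unary.All as All using (All; []; _∷_)
import Data.List.Relation.Unary.All.Properties as All
open import Data.List.Relation.Unary.Any using (here; there)
open import Data.List.Relation.Unary.Linked as Linked using (Linked; _∷_)
import Data.List.Relation.Unary.Linked.Properties as Linked
open import Data.List.Membership.Propositional using (_∈_)
open import Data.List.Membership.Propositional.Properties using (∈-filter⁺; ∈-concat⁺′; ∈-map⁻; ∈-upTo⁻)
open import Data.List.Relation.Binary.Permutation.Propositional using (_↭_; ↭-reflexive; ↭-sym; ↭-trans)
open import Data.List.Relation.Binary.Permutation.Propositional.Properties using (↭-length; filter-↭; ∷↭∷ʳ; ∈-resp-↭)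
open import Data.Maybe using (Maybe; just; nothing)
import Data.Maybe.Relation.Unary.All as Maybe
open import Data.Product using (_×_; _,_; proj₁; proj₂; map₁; map₂)
import Data.Product as Product
open import Data.Unit using (tt)
open import Data.Empty using (⊥-elim)
open import Function using (_∘_)
open import Function.Definitions using (Injective)
open import Relation.Nullary using (¬?; yes; no; ofʸ; ofⁿ)
open import Relation.Binary using (tri<; tri≈; tri>)
open import Relation.Binary.PropositionalEquality using (_≡_; _≢_; refl; sym; trans; cong; cong₂; subst; module ≡-Reasoning)
open ≡-Reasoning

dropEntry : ℕ → List ℕ → List ℕ
dropEntry m = filter (λ e → ¬? (e ≟ m))

dropEntry-keep : ∀ {m x} xs → x ≢ m → dropEntry m (x ∷ xs) ≡ x ∷ dropEntry m xs
dropEntry-keep {m} _ = filter-accept (λ e → ¬? (e ≟ m))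

dropEntry-drop : ∀ m xs → dropEntry m (m ∷ xs) ≡ dropEntry m xs
dropEntry-drop m _ = filter-reject (λ e → ¬? (e ≟ m)) (λ m≢m → m≢m refl)

dropEntry-absent : ∀ {m xs} → All (_≢ m) xs → dropEntry m xs ≡ xs
dropEntry-absent {m} = filter-all (λ e → ¬? (e ≟ m))

dropEntry-∷ʳ : ∀ m xs → dropEntry m (xs ∷ʳ m) ≡ dropEntry m xs
dropEntry-∷ʳ m xs = begin
  dropEntry m (xs ++ [ m ])             ≡⟨ filter-++ (λ e → ¬? (e ≟ m)) xs [ m ] ⟩
  dropEntry m xs ++ dropEntry m [ m ]   ≡⟨ cong (dropEntry m xs ++_) (dropEntry-drop m []) ⟩
  dropEntry m xs ++ []                  ≡⟨ ++-identityʳ _ ⟩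
  dropEntry m xs                        ∎

dropEntry-map : ∀ {f : ℕ → ℕ} → Injective _≡_ _≡_ f →
                ∀ m xs → dropEntry (f m) (map f xs) ≡ map f (dropEntry m xs)
dropEntry-map {f} inj m [] = refl
dropEntry-map {f} inj m (x ∷ xs) with x ≟ m
... | yes refl = begin
  dropEntry (f x) (f x ∷ map f xs)   ≡⟨ dropEntry-drop (f x) (map f xs) ⟩
  dropEntry (f x) (map f xs)         ≡⟨ dropEntry-map inj x xs ⟩
  map f (dropEntry x xs)             ≡⟨ cong (map f) (dropEntry-drop x xs) ⟨
  map f (dropEntry x (x ∷ xs))       ∎
... | no x≢m = begin
  dropEntry (f m) (f x ∷ map f xs)   ≡⟨ dropEntry-keep (map f xs) (x≢m ∘ inj) ⟩
  f x ∷ dropEntry (f m) (map f xs)   ≡⟨ cong (f x ∷_) (dropEntry-map inj m xs) ⟩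
  f x ∷ map f (dropEntry m xs)       ≡⟨ cong (map f) (dropEntry-keep xs x≢m) ⟨
  map f (dropEntry m (x ∷ xs))       ∎

∈⇒NonEmptyRow : ∀ {x xs} → x ∈ xs → NonEmptyRow xs
∈⇒NonEmptyRow {xs = _ ∷ _} _ = tt

consRow : List ℕ → Tableau → Tableau
consRow []       T = T
consRow (x ∷ xs) T = (x ∷ xs) ∷ T

consRow-nonEmpty : ∀ {r} T → NonEmptyRow r → consRow r T ≡ r ∷ T
consRow-nonEmpty {_ ∷ _} _ _ = refl

consRow-map : ∀ (f : ℕ → ℕ) r T → consRow (map f r) (map (map f) T) ≡ map (map f) (consRow r T)
consRow-map f []      T = refl
consRow-map f (_ ∷ _) T = refl

removeEntry-∷ : ∀ m r rs → removeEntry m (r ∷ rs) ≡ consRow (dropEntry m r) (removeEntry m rs)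
removeEntry-∷ m r rs with dropEntry m r
... | []    = refl
... | _ ∷ _ = refl

removeEntry-absent : ∀ {m T} → All NonEmptyRow T → All (All (_≢ m)) T → removeEntry m T ≡ T
removeEntry-absent []       []       = refl
removeEntry-absent {m} {r ∷ rs} (ne ∷ nes) (r≢m ∷ rs≢m) = begin
  removeEntry m (r ∷ rs)                       ≡⟨ removeEntry-∷ m r rs ⟩
  consRow (dropEntry m r) (removeEntry m rs)   ≡⟨ cong₂ consRow (dropEntry-absent r≢m) (removeEntry-absent nes rs≢m) ⟩
  consRow r rs                                 ≡⟨ consRow-nonEmpty rs ne ⟩
  r ∷ rs                                       ∎

removeEntry-map : ∀ {f : ℕ → ℕ} → Injective _≡_ _≡_ f →
                  ∀ m T → removeEntry (f m) (map (map f) T) ≡ map (map f) (removeEntry m T)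
removeEntry-map inj m [] = refl
removeEntry-map {f} inj m (r ∷ rs) = begin
  removeEntry (f m) (map f r ∷ map (map f) rs)
    ≡⟨ removeEntry-∷ (f m) (map f r) (map (map f) rs) ⟩
  consRow (dropEntry (f m) (map f r)) (removeEntry (f m) (map (map f) rs))
    ≡⟨ cong₂ consRow (dropEntry-map inj m r) (removeEntry-map inj m rs) ⟩
  consRow (map f (dropEntry m r)) (map (map f) (removeEntry m rs))
    ≡⟨ consRow-map f (dropEntry m r) (removeEntry m rs) ⟩
  map (map f) (consRow (dropEntry m r) (removeEntry m rs))
    ≡⟨ cong (map (map f)) (removeEntry-∷ m r rs) ⟨
  map (map f) (removeEntry m (r ∷ rs))
    ∎

insertBelow : List ℕ × Maybe ℕ → Tableau → Tableau
insertBelow (r , nothing) rs = r ∷ rs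
insertBelow (r , just y)  rs = r ∷ rowInsert y rs

rowInsert-∷ : ∀ x r rs → rowInsert x (r ∷ rs) ≡ insertBelow (bump x r) rs
rowInsert-∷ x r rs with bump x r
... | _ , nothing = refl
... | _ , just _  = refl

bump-< : ∀ {x y} ys → x < y → bump x (y ∷ ys) ≡ (x ∷ ys , just y)
bump-< {x} {y} ys x<y with suc x ≤ᵇ y | ≤ᵇ-reflects-≤ (suc x) y
... | true  | _        = refl
... | false | ofⁿ x≮y = ⊥-elim (x≮y x<y)

bump-≥ : ∀ {x y} ys → y ≤ x → bump x (y ∷ ys) ≡ map₁ (y ∷_) (bump x ys)
bump-≥ {x} {y} ys y≤x with suc x ≤ᵇ y | ≤ᵇ-reflects-≤ (suc x) y
... | false | _        = refl
... | true  | ofʸ x<y = ⊥-elim (<⇒≱ x<y y≤x)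

bump-append : ∀ {x} r → All (_≤ x) r → bump x r ≡ (r ∷ʳ x , nothing)
bump-append []       []           = refl
bump-append (y ∷ ys) (y≤x ∷ ys≤x) = trans (bump-≥ ys y≤x) (cong (map₁ (y ∷_)) (bump-append ys ys≤x))

bump-inserts : ∀ x r → x ∈ proj₁ (bump x r)
bump-inserts x []       = here refl
bump-inserts x (y ∷ ys) with x <? y
... | yes x<y rewrite bump-< ys x<y = here refl
... | no  x≮y rewrite bump-≥ ys (≮⇒≥ x≮y) = there (bump-inserts x ys)

bump-bumped : ∀ {P : ℕ → Set} x {r} → All P r → Maybe.All P (proj₂ (bump x r))
bump-bumped x []                  = Maybe.nothing
bump-bumped x {y ∷ ys} (py ∷ pys) with x <? y
... | yes x<y rewrite bump-< ys x<y = Maybe.just py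
... | no  x≮y rewrite bump-≥ ys (≮⇒≥ x≮y) = bump-bumped x pys

bump-length : ∀ x r → length (proj₁ (bump x r)) + length (fromMaybe (proj₂ (bump x r))) ≡ suc (length r)
bump-length x []       = refl
bump-length x (y ∷ ys) with x <? y
... | yes x<y rewrite bump-< ys x<y = cong suc (+-comm (length ys) 1)
... | no  x≮y rewrite bump-≥ ys (≮⇒≥ x≮y) = cong suc (bump-length x ys)

dropBumped : ℕ → Maybe ℕ → Maybe ℕ
dropBumped m nothing  = nothing
dropBumped m (just y) with y ≟ m
... | yes _ = nothing
... | no  _ = just y

dropBumped-self : ∀ m → dropBumped m (just m) ≡ nothing
dropBumped-self m with m ≟ m
... | yes _   = refl
... | no  m≢m = ⊥-elim (m≢m refl)

dropBumped-other : ∀ {m y} → y ≢ m → dropBumped m (just y) ≡ just y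
dropBumped-other {m} {y} y≢m with y ≟ m
... | yes y≡m = ⊥-elim (y≢m y≡m)
... | no  _   = refl

-- The hypotheses make m, if present, the last entry of the row; if x bumps it, it
-- simply disappears.
bump-dropEntry : ∀ {m x r} → x < m → Linked _<_ r → All (_≤ m) r →
                 bump x (dropEntry m r) ≡ Product.map (dropEntry m) (dropBumped m) (bump x r)
bump-dropEntry {m} {x} {[]} x<m _ _ = cong (_, nothing) (sym (dropEntry-keep [] (<⇒≢ x<m)))
bump-dropEntry {m} {x} {y ∷ ys} x<m incr (y≤m ∷ ys≤m) with x <? y | y ≟ m
... | yes x<y | yes refl = bumps-max ys incr ys≤m
  where
  bumps-max : ∀ ys → Linked _<_ (m ∷ ys) → All (_≤ m) ys →
              bump x (dropEntry m (m ∷ ys)) ≡ Product.map (dropEntry m) (dropBumped m) (bump x (m ∷ ys))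
  bumps-max (z ∷ _) (m<z ∷ _) (z≤m ∷ _) = ⊥-elim (<⇒≱ m<z z≤m)
  bumps-max [] _ _ = begin
    bump x (dropEntry m [ m ])                         ≡⟨ cong (bump x) (dropEntry-drop m []) ⟩
    ([ x ] , nothing)                                  ≡⟨ cong₂ _,_ (dropEntry-keep [] (<⇒≢ x<m)) (dropBumped-self m) ⟨
    (dropEntry m [ x ] , dropBumped m (just m))        ≡⟨ cong (Product.map (dropEntry m) (dropBumped m)) (bump-< [] x<m) ⟨
    Product.map (dropEntry m) (dropBumped m) (bump x [ m ]) ∎
... | yes x<y | no y≢m = begin
  bump x (dropEntry m (y ∷ ys))                         ≡⟨ cong (bump x) (dropEntry-keep ys y≢m) ⟩
  bump x (y ∷ dropEntry m ys)                           ≡⟨ bump-< (dropEntry m ys) x<y ⟩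
  (x ∷ dropEntry m ys , just y)                         ≡⟨ cong₂ _,_ (dropEntry-keep ys (<⇒≢ x<m)) (dropBumped-other y≢m) ⟨
  (dropEntry m (x ∷ ys) , dropBumped m (just y))        ≡⟨ cong (Product.map (dropEntry m) (dropBumped m)) (bump-< ys x<y) ⟨
  Product.map (dropEntry m) (dropBumped m) (bump x (y ∷ ys)) ∎
... | no x≮y | _ = begin
  bump x (dropEntry m (y ∷ ys))                         ≡⟨ cong (bump x) (dropEntry-keep ys y≢m) ⟩
  bump x (y ∷ dropEntry m ys)                           ≡⟨ bump-≥ (dropEntry m ys) y≤x ⟩
  map₁ (y ∷_) (bump x (dropEntry m ys))                 ≡⟨ cong (map₁ (y ∷_)) (bump-dropEntry x<m (Linked.tail incr) ys≤m) ⟩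
  map₁ (y ∷_) (Product.map (dropEntry m) (dropBumped m) (bump x ys))
                                                        ≡⟨ cong (_, _) (dropEntry-keep (proj₁ (bump x ys)) y≢m) ⟨
  Product.map (dropEntry m) (dropBumped m) (map₁ (y ∷_) (bump x ys))
                                                        ≡⟨ cong (Product.map (dropEntry m) (dropBumped m)) (bump-≥ ys y≤x) ⟨
  Product.map (dropEntry m) (dropBumped m) (bump x (y ∷ ys)) ∎
  where
  y≤x : y ≤ x
  y≤x = ≮⇒≥ x≮y
  y≢m : y ≢ m
  y≢m = <⇒≢ (≤-<-trans y≤x x<m)

-- Like IsSYT, but the entries need only be bounded: shifted tableaux skip a value.
record IsTableau≤ (m : ℕ) (T : Tableau) : Set where
  field
    rowsNonEmpty : All NonEmptyRow T
    rowsIncr     : All (Linked _<_) T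
    bounded      : All (All (_≤ m)) T
    colsIncr     : Linked Below T

open IsTableau≤

IsTableau≤-tail : ∀ {m r rs} → IsTableau≤ m (r ∷ rs) → IsTableau≤ m rs
IsTableau≤-tail t = record
  { rowsNonEmpty = All.tail (rowsNonEmpty t)
  ; rowsIncr     = All.tail (rowsIncr t)
  ; bounded      = All.tail (bounded t)
  ; colsIncr     = Linked.tail (colsIncr t)
  }

dropEntry≡[]⇒head≡ : ∀ {m w} ws → dropEntry m (w ∷ ws) ≡ [] → w ≡ m
dropEntry≡[]⇒head≡ {m} {w} ws dropped with w ≟ m
... | yes w≡m = w≡m
... | no  w≢m with () ← trans (sym (dropEntry-keep ws w≢m)) dropped

dropEntry≡[]⇒lastRow : ∀ {m r rs} → IsTableau≤ m (r ∷ rs) → dropEntry m r ≡ [] → rs ≡ []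
dropEntry≡[]⇒lastRow {r = []} t _ with rowsNonEmpty t
... | () ∷ _
dropEntry≡[]⇒lastRow {r = _ ∷ _} {[]} _ _ = refl
dropEntry≡[]⇒lastRow {r = _ ∷ _} {[] ∷ _} t _ with rowsNonEmpty t
... | _ ∷ () ∷ _
dropEntry≡[]⇒lastRow {r = w ∷ ws} {(z ∷ _) ∷ _} t dropped with colsIncr t | bounded t
... | (w<z , _) ∷ _ | _ ∷ (z≤m ∷ _) ∷ _ =
  ⊥-elim (<⇒≱ (subst (_< z) (dropEntry≡[]⇒head≡ ws dropped) w<z) z≤m)

rowInsert-consRow : ∀ x r {T} → (r ≡ [] → T ≡ []) → rowInsert x (consRow r T) ≡ insertBelow (bump x r) T
rowInsert-consRow x []      vanishes rewrite vanishes refl = refl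
rowInsert-consRow x (y ∷ ys) _ = rowInsert-∷ x (y ∷ ys) _

removeEntry-rowInsert-max : ∀ {m} T → All (All (_≤ m)) T → removeEntry m (rowInsert m T) ≡ removeEntry m T
removeEntry-rowInsert-max {m} [] [] = trans (removeEntry-∷ m [ m ] []) (cong (λ r → consRow r []) (dropEntry-drop m []))
removeEntry-rowInsert-max {m} (r ∷ rs) (r≤m ∷ _) = begin
  removeEntry m (rowInsert m (r ∷ rs))                ≡⟨ cong (removeEntry m) (rowInsert-∷ m r rs) ⟩
  removeEntry m (insertBelow (bump m r) rs)           ≡⟨ cong (λ b → removeEntry m (insertBelow b rs)) (bump-append r r≤m) ⟩
  removeEntry m ((r ∷ʳ m) ∷ rs)                       ≡⟨ removeEntry-∷ m (r ∷ʳ m) rs ⟩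
  consRow (dropEntry m (r ∷ʳ m)) (removeEntry m rs)   ≡⟨ cong (λ r′ → consRow r′ (removeEntry m rs)) (dropEntry-∷ʳ m r) ⟩
  consRow (dropEntry m r) (removeEntry m rs)          ≡⟨ removeEntry-∷ m r rs ⟨
  removeEntry m (r ∷ rs)                              ∎

removeEntry-rowInsert : ∀ {m x} T → x < m → IsTableau≤ m T →
                        removeEntry m (rowInsert x T) ≡ rowInsert x (removeEntry m T)
removeEntry-rowInsert {m} {x} [] x<m _ = trans (removeEntry-∷ m [ x ] []) (cong (λ r → consRow r []) (dropEntry-keep [] (<⇒≢ x<m)))
removeEntry-rowInsert {m} {x} (r ∷ rs) x<m t = begin
  removeEntry m (rowInsert x (r ∷ rs))
    ≡⟨ cong (removeEntry m) (rowInsert-∷ x r rs) ⟩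
  removeEntry m (insertBelow (bump x r) rs)
    ≡⟨ removeEntry-insertBelow (bump x r) (∈⇒NonEmptyRow (∈-filter⁺ (λ e → ¬? (e ≟ m)) (bump-inserts x r) (<⇒≢ x<m)))
                               (bump-bumped x (All.head (bounded t))) ⟩
  insertBelow (Product.map (dropEntry m) (dropBumped m) (bump x r)) (removeEntry m rs)
    ≡⟨ cong (λ b → insertBelow b (removeEntry m rs)) (bump-dropEntry x<m (All.head (rowsIncr t)) (All.head (bounded t))) ⟨
  insertBelow (bump x (dropEntry m r)) (removeEntry m rs)
    ≡⟨ rowInsert-consRow x (dropEntry m r) (cong (removeEntry m) ∘ dropEntry≡[]⇒lastRow t) ⟨
  rowInsert x (consRow (dropEntry m r) (removeEntry m rs))
    ≡⟨ cong (rowInsert x) (removeEntry-∷ m r rs) ⟨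
  rowInsert x (removeEntry m (r ∷ rs))
    ∎
  where
  removeEntry-insertBelow : ∀ b → NonEmptyRow (dropEntry m (proj₁ b)) → Maybe.All (_≤ m) (proj₂ b) →
    removeEntry m (insertBelow b rs) ≡ insertBelow (Product.map (dropEntry m) (dropBumped m) b) (removeEntry m rs)
  removeEntry-insertBelow (r′ , nothing) ne _ =
    trans (removeEntry-∷ m r′ rs) (consRow-nonEmpty _ ne)
  removeEntry-insertBelow (r′ , just y) ne (Maybe.just y≤m) with y ≟ m
  ... | yes refl = begin
    removeEntry m (r′ ∷ rowInsert m rs)                        ≡⟨ removeEntry-∷ m r′ (rowInsert m rs) ⟩
    consRow (dropEntry m r′) (removeEntry m (rowInsert m rs))  ≡⟨ consRow-nonEmpty _ ne ⟩
    dropEntry m r′ ∷ removeEntry m (rowInsert m rs)            ≡⟨ cong (dropEntry m r′ ∷_) (removeEntry-rowInsert-max rs (All.tail (bounded t))) ⟩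
    dropEntry m r′ ∷ removeEntry m rs                          ∎
  ... | no y≢m = begin
    removeEntry m (r′ ∷ rowInsert y rs)                        ≡⟨ removeEntry-∷ m r′ (rowInsert y rs) ⟩
    consRow (dropEntry m r′) (removeEntry m (rowInsert y rs))  ≡⟨ consRow-nonEmpty _ ne ⟩
    dropEntry m r′ ∷ removeEntry m (rowInsert y rs)            ≡⟨ cong (dropEntry m r′ ∷_) (removeEntry-rowInsert rs (≤∧≢⇒< y≤m y≢m) (IsTableau≤-tail t)) ⟩
    dropEntry m r′ ∷ rowInsert y (removeEntry m rs)            ∎

shiftFrom : ℕ → ℕ → ℕ
shiftFrom k e = if k ≤ᵇ e then suc e else e

shiftEntries : ℕ → Tableau → Tableau
shiftEntries k = map (map (shiftFrom k))

shiftFrom-≥ : ∀ {k e} → k ≤ e → shiftFrom k e ≡ suc e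
shiftFrom-≥ {k} {e} k≤e with k ≤ᵇ e | ≤ᵇ-reflects-≤ k e
... | true  | _        = refl
... | false | ofⁿ k≰e = ⊥-elim (k≰e k≤e)

shiftFrom-< : ∀ {k e} → e < k → shiftFrom k e ≡ e
shiftFrom-< {k} {e} e<k with k ≤ᵇ e | ≤ᵇ-reflects-≤ k e
... | false | _        = refl
... | true  | ofʸ k≤e = ⊥-elim (<⇒≱ e<k k≤e)

shiftFrom-strictMono : ∀ k {a b} → a < b → shiftFrom k a < shiftFrom k b
shiftFrom-strictMono k {a} {b} a<b with k ≤? a | k ≤? b
... | yes k≤a | yes k≤b rewrite shiftFrom-≥ k≤a | shiftFrom-≥ k≤b = s≤s a<b
... | yes k≤a | no  k≰b = ⊥-elim (k≰b (≤-trans k≤a (<⇒≤ a<b)))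
... | no  k≰a | yes k≤b rewrite shiftFrom-< (≰⇒> k≰a) | shiftFrom-≥ k≤b = m<n⇒m<1+n a<b
... | no  k≰a | no  k≰b rewrite shiftFrom-< (≰⇒> k≰a) | shiftFrom-< (≰⇒> k≰b) = a<b

shiftFrom-≤ : ∀ k {e n} → e ≤ n → shiftFrom k e ≤ suc n
shiftFrom-≤ k {e} e≤n with k ≤? e
... | yes k≤e rewrite shiftFrom-≥ k≤e = s≤s e≤n
... | no  k≰e rewrite shiftFrom-< (≰⇒> k≰e) = m≤n⇒m≤1+n e≤n

strictMono⇒injective : ∀ {f : ℕ → ℕ} → (∀ {a b} → a < b → f a < f b) → Injective _≡_ _≡_ f
strictMono⇒injective mono {a} {b} fa≡fb with <-cmp a b
... | tri< a<b _ _ = ⊥-elim (<⇒≢ (mono a<b) fa≡fb)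
... | tri≈ _ a≡b _ = a≡b
... | tri> _ _ b<a = ⊥-elim (<⇒≢ (mono b<a) (sym fa≡fb))

Below-map : ∀ {f : ℕ → ℕ} → (∀ {a b} → a < b → f a < f b) → ∀ r r′ → Below r r′ → Below (map f r) (map f r′)
Below-map mono _        []       _              = tt
Below-map mono (x ∷ xs) (y ∷ ys) (x<y , below) = mono x<y , Below-map mono xs ys below

IsTableau≤-map : ∀ {f : ℕ → ℕ} {m m′ T} → (∀ {a b} → a < b → f a < f b) → (∀ {e} → e ≤ m → f e ≤ m′) →
                 IsTableau≤ m T → IsTableau≤ m′ (map (map f) T)
IsTableau≤-map {f} mono bound t = record
  { rowsNonEmpty = All.map⁺ (All.map nonEmpty-map (rowsNonEmpty t))
  ; rowsIncr     = All.map⁺ (All.map (λ incr → Linked.map⁺ (Linked.map mono incr)) (rowsIncr t))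
  ; bounded      = All.map⁺ (All.map (λ r≤m → All.map⁺ (All.map bound r≤m)) (bounded t))
  ; colsIncr     = Linked.map⁺ (Linked.map (Below-map mono _ _) (colsIncr t))
  }
  where
  nonEmpty-map : ∀ {r} → NonEmptyRow r → NonEmptyRow (map f r)
  nonEmpty-map {_ ∷ _} _ = tt

-- ins k P unfolds definitionally to rowInsert k (shiftEntries k P).

removeEntry-ins-max : ∀ {n P} → IsTableau≤ n P → removeEntry (suc n) (ins (suc n) P) ≡ P
removeEntry-ins-max {n} {P} t = begin
  removeEntry (suc n) (rowInsert (suc n) (shiftEntries (suc n) P))
    ≡⟨ cong (removeEntry (suc n) ∘ rowInsert (suc n)) shift-id ⟩
  removeEntry (suc n) (rowInsert (suc n) P)
    ≡⟨ removeEntry-rowInsert-max P (All.map (All.map m≤n⇒m≤1+n) (bounded t)) ⟩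
  removeEntry (suc n) P
    ≡⟨ removeEntry-absent (rowsNonEmpty t) (All.map (All.map (λ e≤n → <⇒≢ (s≤s e≤n))) (bounded t)) ⟩
  P ∎
  where
  shift-id : shiftEntries (suc n) P ≡ P
  shift-id = map-id-local (All.map (λ r≤n → map-id-local (All.map (λ e≤n → shiftFrom-< (s≤s e≤n)) r≤n)) (bounded t))

removeEntry-ins : ∀ {n P k} → k < n → IsTableau≤ n P →
                  removeEntry (suc n) (ins (suc k) P) ≡ ins (suc k) (removeEntry n P)
removeEntry-ins {n} {P} {k} k<n t = begin
  removeEntry (suc n) (rowInsert (suc k) (shiftEntries (suc k) P))
    ≡⟨ removeEntry-rowInsert (shiftEntries (suc k) P) (s≤s k<n)
         (IsTableau≤-map (shiftFrom-strictMono (suc k)) (shiftFrom-≤ (suc k)) t) ⟩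
  rowInsert (suc k) (removeEntry (suc n) (shiftEntries (suc k) P))
    ≡⟨ cong (λ m → rowInsert (suc k) (removeEntry m (shiftEntries (suc k) P))) (shiftFrom-≥ k<n) ⟨
  rowInsert (suc k) (removeEntry (shiftFrom (suc k) n) (shiftEntries (suc k) P))
    ≡⟨ cong (rowInsert (suc k)) (removeEntry-map (strictMono⇒injective (shiftFrom-strictMono (suc k))) n P) ⟩
  rowInsert (suc k) (shiftEntries (suc k) (removeEntry n P)) ∎

IsSYT⇒IsTableau≤ : ∀ {n P} → IsSYT n P → IsTableau≤ n P
IsSYT⇒IsTableau≤ {n} syt = record
  { rowsNonEmpty = IsSYT.rowsNonEmpty syt
  ; rowsIncr     = IsSYT.rowsIncr syt
  ; bounded      = All.tabulate λ r∈P → All.tabulate λ x∈r →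
                     entry≤n (∈-resp-↭ (IsSYT.entries syt) (∈-concat⁺′ x∈r r∈P))
  ; colsIncr     = IsSYT.colsIncr syt
  }
  where
  entry≤n : ∀ {x} → x ∈ map suc (upTo n) → x ≤ n
  entry≤n x∈ with ∈-map⁻ suc x∈
  ... | _ , i∈ , refl = ∈-upTo⁻ i∈

size≡length-concat : ∀ T → size T ≡ length (concat T)
size≡length-concat []       = refl
size≡length-concat (r ∷ rs) = trans (cong (length r +_) (size≡length-concat rs)) (sym (length-++ r))

size-consRow : ∀ r T → size (consRow r T) ≡ length r + size T
size-consRow []      _ = refl
size-consRow (_ ∷ _) _ = refl

size-map : ∀ (f : ℕ → ℕ) T → size (map (map f) T) ≡ size T
size-map f []       = refl
size-map f (r ∷ rs) = cong₂ _+_ (length-map f r) (size-map f rs)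

size-rowInsert : ∀ x T → size (rowInsert x T) ≡ suc (size T)
size-rowInsert x []       = refl
size-rowInsert x (r ∷ rs) = begin
  size (rowInsert x (r ∷ rs))                                           ≡⟨ cong size (rowInsert-∷ x r rs) ⟩
  size (insertBelow (bump x r) rs)                                      ≡⟨ size-insertBelow (bump x r) ⟩
  length (proj₁ (bump x r)) + length (fromMaybe (proj₂ (bump x r))) + size rs ≡⟨ cong (_+ size rs) (bump-length x r) ⟩
  suc (length r + size rs)                                              ∎
  where
  size-insertBelow : ∀ b → size (insertBelow b rs) ≡ length (proj₁ b) + length (fromMaybe (proj₂ b)) + size rs
  size-insertBelow (r′ , nothing) = cong (_+ size rs) (sym (+-identityʳ (length r′)))
  size-insertBelow (r′ , just y)  = begin
    length r′ + size (rowInsert y rs) ≡⟨ cong (length r′ +_) (size-rowInsert y rs) ⟩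
    length r′ + suc (size rs)         ≡⟨ +-assoc (length r′) 1 (size rs) ⟨
    length r′ + 1 + size rs           ∎

size-ins : ∀ k P → size (ins k P) ≡ suc (size P)
size-ins k P = trans (size-rowInsert k (shiftEntries k P)) (cong suc (size-map (shiftFrom k) P))

size-removeEntry : ∀ m T → size (removeEntry m T) ≡ length (dropEntry m (concat T))
size-removeEntry m []       = refl
size-removeEntry m (r ∷ rs) = begin
  size (removeEntry m (r ∷ rs))                              ≡⟨ cong size (removeEntry-∷ m r rs) ⟩
  size (consRow (dropEntry m r) (removeEntry m rs))          ≡⟨ size-consRow (dropEntry m r) (removeEntry m rs) ⟩
  length (dropEntry m r) + size (removeEntry m rs)           ≡⟨ cong (length (dropEntry m r) +_) (size-removeEntry m rs) ⟩
  length (dropEntry m r) + length (dropEntry m (concat rs))  ≡⟨ length-++ (dropEntry m r) ⟨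
  length (dropEntry m r ++ dropEntry m (concat rs))          ≡⟨ cong length (filter-++ (λ e → ¬? (e ≟ m)) r (concat rs)) ⟨
  length (dropEntry m (r ++ concat rs))                      ∎

size-SYT : ∀ {n P} → IsSYT n P → size P ≡ n
size-SYT {n} {P} syt = begin
  size P                    ≡⟨ size≡length-concat P ⟩
  length (concat P)         ≡⟨ ↭-length (IsSYT.entries syt) ⟩
  length (map suc (upTo n)) ≡⟨ length-map suc (upTo n) ⟩
  length (upTo n)           ≡⟨ length-upTo n ⟩
  n                         ∎

dropEntry-max-upTo : ∀ n → dropEntry (suc n) (map suc (upTo (suc n))) ≡ map suc (upTo n)
dropEntry-max-upTo n = begin
  dropEntry (suc n) (map suc (upTo (suc n)))    ≡⟨ cong (dropEntry (suc n) ∘ map suc) (upTo-∷ʳ n) ⟨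
  dropEntry (suc n) (map suc (upTo n ∷ʳ n))     ≡⟨ cong (dropEntry (suc n)) (map-++ suc (upTo n) [ n ]) ⟩
  dropEntry (suc n) (map suc (upTo n) ∷ʳ suc n) ≡⟨ dropEntry-∷ʳ (suc n) (map suc (upTo n)) ⟩
  dropEntry (suc n) (map suc (upTo n))          ≡⟨ dropEntry-absent (All.map⁺ (All.map (λ i<n → <⇒≢ (s≤s i<n)) (All.all-upTo n))) ⟩
  map suc (upTo n)                              ∎

size-removeEntry-SYT : ∀ {n P} → IsSYT (suc n) P → size (removeEntry (suc n) P) ≡ n
size-removeEntry-SYT {n} {P} syt = begin
  size (removeEntry (suc n) P)                          ≡⟨ size-removeEntry (suc n) P ⟩
  length (dropEntry (suc n) (concat P))                 ≡⟨ ↭-length (filter-↭ (λ e → ¬? (e ≟ suc n)) (IsSYT.entries syt)) ⟩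
  length (dropEntry (suc n) (map suc (upTo (suc n))))   ≡⟨ cong length (dropEntry-max-upTo n) ⟩
  length (map suc (upTo n))                             ≡⟨ length-map suc (upTo n) ⟩
  length (upTo n)                                       ≡⟨ length-upTo n ⟩
  n                                                     ∎

U-basis : ∀ {n} P → size P ≡ n → U P ≡ map (λ k → n ∸ k , ins (suc k) P) (upTo (suc n))
U-basis P sP = trans (trans (++-identityʳ _) (sym (map-∘ (upTo (suc (size P))))))
                     (cong (λ s → map (λ k → s ∸ k , ins (suc k) P) (upTo (suc s))) sP)

Dlin-∷ : ∀ {n e T} xs → size T ≡ suc n → Dlin ((e , T) ∷ xs) ≡ (e , removeEntry (suc n) T) ∷ Dlin xs
Dlin-∷ {n} {e} {T} xs sT with size T | sT
... | _ | refl = cong (λ e′ → (e′ , removeEntry (suc n) T) ∷ Dlin xs) (+-identityʳ e)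

D-empty : ∀ {P} → size P ≡ 0 → D P ≡ []
D-empty {P} sP with size P | sP
... | _ | refl = refl

Dlin-homogeneous : ∀ {n xs} → All (λ t → size (proj₂ t) ≡ suc n) xs →
                   Dlin xs ≡ map (map₂ (removeEntry (suc n))) xs
Dlin-homogeneous []         = refl
Dlin-homogeneous {xs = (_ , T) ∷ xs} (sT ∷ sxs) = trans (Dlin-∷ {T = T} xs sT) (cong (_ ∷_) (Dlin-homogeneous sxs))

DU-term : ℕ → Tableau → ℕ → ℕ × Tableau
DU-term n P k = n ∸ k , removeEntry (suc n) (ins (suc k) P)

DU-basis : ∀ {n} P → size P ≡ n → Dlin (U P) ≡ map (DU-term n P) (upTo (suc n))
DU-basis {n} P sP = begin
  Dlin (U P)                                              ≡⟨ cong Dlin (U-basis P sP) ⟩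
  Dlin (map term (upTo (suc n)))                          ≡⟨ Dlin-homogeneous sizes ⟩
  map (map₂ (removeEntry (suc n))) (map term (upTo (suc n))) ≡⟨ map-∘ (upTo (suc n)) ⟨
  map (DU-term n P) (upTo (suc n))                        ∎
  where
  term : ℕ → ℕ × Tableau
  term k = n ∸ k , ins (suc k) P
  sizes : All (λ t → size (proj₂ t) ≡ suc n) (map term (upTo (suc n)))
  sizes = All.map⁺ (All.universal (λ k → trans (size-ins (suc k) P) (cong suc sP)) (upTo (suc n)))

qScale-UD : ∀ {n P} → IsSYT n P → qScale (Ulin (D P)) ≡ map (DU-term n P) (upTo n)
qScale-UD {zero}  {P} syt = cong (qScale ∘ Ulin) (D-empty {P} (size-SYT syt))
qScale-UD {suc n} {P} syt = begin
  qScale (Ulin (D P))                                          ≡⟨ cong (qScale ∘ Ulin) (Dlin-∷ {T = P} [] (size-SYT syt)) ⟩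
  qScale (U P⁻)                                                ≡⟨ cong qScale (U-basis P⁻ (size-removeEntry-SYT syt)) ⟩
  qScale (map (λ k → n ∸ k , ins (suc k) P⁻) (upTo (suc n)))   ≡⟨ map-∘ (upTo (suc n)) ⟨
  map (λ k → suc (n ∸ k) , ins (suc k) P⁻) (upTo (suc n))      ≡⟨ map-cong-local (All.map term (All.all-upTo (suc n))) ⟩
  map (DU-term (suc n) P) (upTo (suc n))                       ∎
  where
  P⁻ : Tableau
  P⁻ = removeEntry (suc n) P
  term : ∀ {k} → k < suc n → (suc (n ∸ k) , ins (suc k) P⁻) ≡ DU-term (suc n) P k
  term k<1+n = cong₂ _,_ (sym (+-∸-assoc 1 (≤-pred k<1+n)))
                         (sym (removeEntry-ins k<1+n (IsSYT⇒IsTableau≤ syt)))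

DU≡qUD∷ʳid : ∀ {n P} → IsSYT n P → Dlin (U P) ≡ qScale (Ulin (D P)) ∷ʳ (0 , P)
DU≡qUD∷ʳid {n} {P} syt = begin
  Dlin (U P)                      ≡⟨ DU-basis P (size-SYT syt) ⟩
  map A (upTo (suc n))            ≡⟨ cong (map A) (upTo-∷ʳ n) ⟨
  map A (upTo n ∷ʳ n)             ≡⟨ map-++ A (upTo n) [ n ] ⟩
  map A (upTo n) ∷ʳ A n           ≡⟨ cong₂ _∷ʳ_ (qScale-UD syt) top-term ⟨
  qScale (Ulin (D P)) ∷ʳ (0 , P)  ∎
  where
  A : ℕ → ℕ × Tableau
  A = DU-term n P
  top-term : (0 , P) ≡ A n
  top-term = sym (cong₂ _,_ (n∸n≡0 n) (removeEntry-ins-max (IsSYT⇒IsTableau≤ syt)))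

proposition6 : (n : ℕ) (P : Tableau) → IsSYT n P →
    Dlin (U P) ↭ ((0 , P) ∷ qScale (Ulin (D P)))
proposition6 n P syt = ↭-trans (↭-reflexive (DU≡qUD∷ʳid syt)) (↭-sym (∷↭∷ʳ (0 , P) (qScale (Ulin (D P)))))
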